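{- If $m$ is an even positive integer, then for every integer $n\geq 1$ we have $pc(2n,m)=pc(2n+1,m)$.
   Context: A composition of a positive integer $n$ of length $k$ is a sequence $\sigma=(\sigma_1,\ldots,\sigma_k)$ of positive integers with $\sum_i \sigma_i=n$. For an integer $m\geq 1$, $\sigma$ is palindromic modulo $m$ if $\sigma_i\equiv\sigma_{k-i+1}\pmod m$ for all $1\le i\le k$. $pc(n,m)$ denotes the number of compositions of $n$ that are palindromic modulo $m$. -}

module Defs where

open import Data.Nat using (ℕ; zero; suc; _+_; _∸_; _≡ᵇ_; NonZero)
open import Data.Nat.DivMod using (_%_)
open import Data.List using (List; []; _∷_; map; concatMap; reverse; filter; length; upTo)
open import Data.Nat.ListAction using (sum)
open import Data.Nat using (_≟_)
open import Relation.Nullary using (Dec)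
import Data.List.Relation.Binary.Pointwise as PW
open import Data.List.Relation.Unary.All using (All)
open import Data.List.Relation.Binary.Pointwise using (Pointwise)
open import Data.List.Membership.Propositional using (_∈_)
open import Data.Product using (_×_)
open import Data.Bool using (Bool; true; false; _∧_; T)
open import Relation.Binary.PropositionalEquality using (_≡_)

IsComposition : ℕ → List ℕ → Set
IsComposition n σ = All (λ x → NonZero x) σ × sum σ ≡ n

-- Enumeration of all compositions of n (first part k ∈ {1..n}, then a
-- composition of n ∸ k).  The first argument is fuel (≥ n suffices).
compsAux : ℕ → ℕ → List (List ℕ)
compsAux fuel zero = [] ∷ []
compsAux zero (suc n) = []
compsAux (suc fuel) (suc n) =
  concatMap (λ j → map (suc j ∷_) (compsAux fuel (n ∸ j))) (upTo (suc n))

compositions : ℕ → List (List ℕ)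
compositions n = compsAux n n

_≡[mod_]_ : ℕ → (m : ℕ) → .{{NonZero m}} → ℕ → Set
a ≡[mod m ] b = a % m ≡ b % m

PalindromicMod : (m : ℕ) → .{{NonZero m}} → List ℕ → Set
PalindromicMod m σ = Pointwise (λ a b → a ≡[mod m ] b) σ (reverse σ)

palMod? : (m : ℕ) → .{{_ : NonZero m}} → (σ : List ℕ) → Dec (PalindromicMod m σ)
palMod? m σ = PW.decidable (λ a b → (a % m) ≟ (b % m)) σ (reverse σ)

pc : ℕ → (m : ℕ) → .{{NonZero m}} → ℕ
pc n m = length (filter (palMod? m) (compositions n))

-- For even m, two parts σ_i, σ_{k+1-i} that agree modulo m agree modulo 2, so
-- a composition palindromic modulo m of even length has even sum.  A
-- palindromic composition of the odd number 2n+1 therefore has a central part.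
-- Lowering that part by one (deleting it when it is 1) keeps the composition
-- palindromic and gives one of 2n; conversely, inserting a central 1 into an
-- even-length composition, or raising the central part of an odd-length one,
-- undoes it, and the two operations are mutually inverse.
module Submission where

open import Defs
import Algebra.Properties.CommutativeSemigroup
open import Data.List using (List; []; _∷_; _++_; _∷ʳ_; map; reverse; filter; length; upTo)
open import Data.List.Membership.Propositional using (_∈_; find; lose)
open import Data.List.Membership.Propositional.Properties
  using (∈-map⁺; ∈-map⁻; ∈-concatMap⁺; ∈-concatMap⁻; ∈-upTo⁺; ∈-upTo⁻; ∈-filter⁺; ∈-filter⁻)
open import Data.List.Membership.Propositional.Properties.WithK using (unique∧set⇒bag)
open import Data.List.Properties
  using (length-++; length-map; length-reverse; ++-assoc; ∷ʳ-++; reverse-++; map-∘; map-id-local; ∷-injective)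
open import Data.List.Relation.Binary.BagAndSetEquality using (∼bag⇒↭)
open import Data.List.Relation.Binary.Disjoint.Propositional using (Disjoint)
open import Data.List.Relation.Binary.Permutation.Propositional.Properties using (↭-length; ↭-reverse)
open import Data.List.Relation.Binary.Pointwise as Pointwise using (Pointwise; []; _∷_)
open import Data.List.Relation.Unary.All as All using (All; []; _∷_)
open import Data.List.Relation.Unary.Any using (here)
import Data.List.Relation.Unary.All.Properties as All
open import Data.List.Relation.Unary.AllPairs as AllPairs using ([]; _∷_)
import Data.List.Relation.Unary.AllPairs.Properties as AllPairs
open import Data.List.Relation.Unary.Unique.Propositional using (Unique)
import Data.List.Relation.Unary.Unique.Propositional.Properties as Unique
open import Data.List.Reverse using (Reverse; []; _∶_∶ʳ_; reverseView)
open import Data.Nat using (ℕ; zero; suc; _+_; _*_; _∸_; _≤_; s≤s; s≤s⁻¹; NonZero)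
open import Data.Nat.DivMod using (_%_; %-distribˡ-+; m∣n⇒o%n%m≡o%m)
open import Data.Nat.Divisibility
  using (_∣_; _∤_; divides; _∣0; ∣m∣n⇒∣m+n; ∣m+n∣m⇒∣n; ∣1⇒≡1; n∣m⇒m%n≡0; m%n≡0⇒n∣m)
open import Data.Nat.ListAction using (sum)
open import Data.Nat.ListAction.Properties using (sum-++; sum-↭)
open import Data.Nat.Properties
open import Data.Nat.Tactic.RingSolver using (solve-∀)
open import Data.Product using (_×_; _,_; proj₁; proj₂)
open import Function.Base using (id; _∘_)
open import Function.Bundles using (mk⇔)
open import Relation.Binary.PropositionalEquality
open import Relation.Nullary using (contradiction)

private
  module ℕ-+ = Algebra.Properties.CommutativeSemigroup +-commutativeSemigroup

  variable
    A B : Set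
    a b c d n N : ℕ
    xs ys zs mid mid′ σ τ : List A

length-≡-of-inverses : {xs : List A} {ys : List B} (f : A → B) (g : B → A) →
  Unique xs → Unique ys →
  (∀ {x} → x ∈ xs → f x ∈ ys × g (f x) ≡ x) →
  (∀ {y} → y ∈ ys → g y ∈ xs × f (g y) ≡ y) →
  length xs ≡ length ys
length-≡-of-inverses {xs = xs} {ys} f g xs! ys! to from =
  trans (sym (length-map f xs)) (↭-length (∼bag⇒↭ (unique∧set⇒bag fxs! ys! (mk⇔ image⊆ ⊆image))))
  where
    g∘f≡id : map g (map f xs) ≡ xs
    g∘f≡id = trans (sym (map-∘ {g = g} {f = f} xs)) (map-id-local (All.tabulate (proj₂ ∘ to)))
    fxs! : Unique (map f xs)
    fxs! = Unique.map⁻ (subst Unique (sym g∘f≡id) xs!)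
    image⊆ : ∀ {y} → y ∈ map f xs → y ∈ ys
    image⊆ y∈ with ∈-map⁻ f y∈
    ... | _ , x∈ , refl = proj₁ (to x∈)
    ⊆image : ∀ {y} → y ∈ ys → y ∈ map f xs
    ⊆image y∈ = subst (_∈ map f xs) (proj₂ (from y∈)) (∈-map⁺ f (proj₁ (from y∈)))

∈-compsAux⁻ : ∀ fuel n → σ ∈ compsAux fuel n → IsComposition n σ
∈-compsAux⁻ fuel zero (here refl) = [] , refl
∈-compsAux⁻ (suc fuel) (suc n) σ∈ with find (∈-concatMap⁻ _ {xs = upTo (suc n)} σ∈)
... | j , j∈ , τ∈′ with ∈-map⁻ (suc j ∷_) τ∈′
... | τ , τ∈ , refl with ∈-compsAux⁻ fuel (n ∸ j) τ∈
... | τ≠0 , Στ = _ ∷ τ≠0 , trans (cong (suc j +_) Στ) (cong suc (m+[n∸m]≡n (s≤s⁻¹ (∈-upTo⁻ j∈))))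

∈-compsAux⁺ : ∀ fuel n {σ} → n ≤ fuel → IsComposition n σ → σ ∈ compsAux fuel n
∈-compsAux⁺ fuel zero {[]} _ _ = here refl
∈-compsAux⁺ fuel zero {zero ∷ _} _ (() ∷ _ , _)
∈-compsAux⁺ fuel zero {suc _ ∷ _} _ (_ , ())
∈-compsAux⁺ fuel (suc n) {[]} _ (_ , ())
∈-compsAux⁺ (suc fuel) (suc n) {zero ∷ _} _ (() ∷ _ , _)
∈-compsAux⁺ (suc fuel) (suc n) {suc x ∷ σ} (s≤s n≤fuel) (_ ∷ σ≠0 , Σσ) =
  ∈-concatMap⁺ (λ j → map (suc j ∷_) (compsAux fuel (n ∸ j)))
    (lose (∈-upTo⁺ (s≤s x≤n)) (∈-map⁺ (suc x ∷_) (∈-compsAux⁺ fuel (n ∸ x) n∸x≤fuel (σ≠0 , Σσ≡n∸x))))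
  where
    x+Σσ≡n : x + sum σ ≡ n
    x+Σσ≡n = suc-injective Σσ
    x≤n : x ≤ n
    x≤n = subst (x ≤_) x+Σσ≡n (m≤m+n x (sum σ))
    n∸x≤fuel : n ∸ x ≤ fuel
    n∸x≤fuel = ≤-trans (m∸n≤m n x) n≤fuel
    Σσ≡n∸x : sum σ ≡ n ∸ x
    Σσ≡n∸x = trans (sym (m+n∸m≡n x (sum σ))) (cong (_∸ x) x+Σσ≡n)

compsAux-unique : ∀ fuel n → Unique (compsAux fuel n)
compsAux-unique fuel zero = [] ∷ []
compsAux-unique zero (suc n) = []
compsAux-unique (suc fuel) (suc n) =
  Unique.concat⁺
    (All.map⁺ (All.universal (λ j → Unique.map⁺ (proj₂ ∘ ∷-injective) (compsAux-unique fuel (n ∸ j))) (upTo (suc n))))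
                 (AllPairs.map⁺ (AllPairs.map firstPartsDiffer (Unique.upTo⁺ (suc n))))
  where
    firstPartsDiffer : ∀ {i j} → i ≢ j →
      Disjoint (map (suc i ∷_) (compsAux fuel (n ∸ i))) (map (suc j ∷_) (compsAux fuel (n ∸ j)))
    firstPartsDiffer i≢j (σ∈ᵢ , σ∈ⱼ) with ∈-map⁻ _ σ∈ᵢ | ∈-map⁻ _ σ∈ⱼ
    ... | _ , _ , refl | _ , _ , eq = i≢j (suc-injective (proj₁ (∷-injective eq)))

IsComposition-swapCentre : ∀ xs {mid mid′} ys → All NonZero mid′ →
  (∀ s → sum mid + s ≡ n → sum mid′ + s ≡ N) →
  IsComposition n (xs ++ mid ++ ys) → IsComposition N (xs ++ mid′ ++ ys)
IsComposition-swapCentre xs {mid} {mid′} ys mid′≠0 sums (≠0 , Σ≡n) =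
  All.++⁺ (All.++⁻ˡ xs ≠0) (All.++⁺ mid′≠0 (All.++⁻ʳ mid (All.++⁻ʳ xs ≠0))) ,
  trans (sum-centre mid′) (sums (sum xs + sum ys) (trans (sym (sum-centre mid)) Σ≡n))
  where
    sum-centre : ∀ zs → sum (xs ++ zs ++ ys) ≡ sum zs + (sum xs + sum ys)
    sum-centre zs = trans (sum-++ xs (zs ++ ys))
      (trans (cong (sum xs +_) (sum-++ zs ys)) (ℕ-+.x∙yz≈y∙xz (sum xs) (sum zs) (sum ys)))

Palindromic : (A → A → Set) → List A → Set
Palindromic R σ = Pointwise R σ (reverse σ)

Pointwise-++⁻ : {R : A → B → Set} {ws : List B} → length xs ≡ length ws →
  Pointwise R (xs ++ ys) (ws ++ zs) → Pointwise R xs ws × Pointwise R ys zs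
Pointwise-++⁻ {xs = []} {ws = []} _ rs = [] , rs
Pointwise-++⁻ {xs = _ ∷ _} {ws = _ ∷ _} eq (r ∷ rs) with Pointwise-++⁻ (suc-injective eq) rs
... | rs₁ , rs₂ = r ∷ rs₁ , rs₂

reverse-++-centre : ∀ (xs mid ys : List A) → reverse (xs ++ mid ++ ys) ≡ reverse ys ++ reverse mid ++ reverse xs
reverse-++-centre xs mid ys = begin
  reverse (xs ++ mid ++ ys)               ≡⟨ reverse-++ xs (mid ++ ys) ⟩
  reverse (mid ++ ys) ++ reverse xs       ≡⟨ cong (_++ reverse xs) (reverse-++ mid ys) ⟩
  (reverse ys ++ reverse mid) ++ reverse xs ≡⟨ ++-assoc (reverse ys) (reverse mid) (reverse xs) ⟩
  reverse ys ++ reverse mid ++ reverse xs ∎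
  where open ≡-Reasoning

module _ {R : A → A → Set} where

  Palindromic-++-centre⁻ : ∀ xs {mid} ys → length xs ≡ length ys → Palindromic R (xs ++ mid ++ ys) →
    Pointwise R xs (reverse ys) × Pointwise R ys (reverse xs)
  Palindromic-++-centre⁻ xs {mid} ys |xs|≡|ys| pal
    with Pointwise-++⁻ (trans |xs|≡|ys| (sym (length-reverse ys))) (subst (Pointwise R _) (reverse-++-centre xs mid ys) pal)
  ... | outer , rest = outer , proj₂ (Pointwise-++⁻ (sym (length-reverse mid)) rest)

  Palindromic-++-centre⁺ : Pointwise R xs (reverse ys) → Palindromic R mid → Pointwise R ys (reverse xs) →
    Palindromic R (xs ++ mid ++ ys)
  Palindromic-++-centre⁺ {xs = xs} {ys = ys} {mid = mid} left centre right =
    subst (Pointwise R _) (sym (reverse-++-centre xs mid ys)) (Pointwise.++⁺ left (Pointwise.++⁺ centre right))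

  Palindromic-swapCentre : ∀ xs {mid mid′} ys → length xs ≡ length ys → Palindromic R mid′ →
    Palindromic R (xs ++ mid ++ ys) → Palindromic R (xs ++ mid′ ++ ys)
  Palindromic-swapCentre xs {mid} ys |xs|≡|ys| centre pal with Palindromic-++-centre⁻ xs {mid} ys |xs|≡|ys| pal
  ... | left , right = Palindromic-++-centre⁺ left centre right

2∣n+n : ∀ n → 2 ∣ n + n
2∣n+n n = divides n (trans (cong (n +_) (sym (+-identityʳ n))) (*-comm 2 n))

2∣+-of-≡mod2 : a % 2 ≡ b % 2 → 2 ∣ a + b
2∣+-of-≡mod2 {a} {b} a≡b = m%n≡0⇒n∣m (a + b) 2 (begin
  (a + b) % 2         ≡⟨ %-distribˡ-+ a b 2 ⟩
  (a % 2 + b % 2) % 2 ≡⟨ cong (λ r → (r + b % 2) % 2) a≡b ⟩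
  (b % 2 + b % 2) % 2 ≡⟨ n∣m⇒m%n≡0 _ 2 (2∣n+n (b % 2)) ⟩
  0                   ∎)
  where open ≡-Reasoning

∣sum+sum : Pointwise (λ a b → d ∣ a + b) xs zs → d ∣ sum xs + sum zs
∣sum+sum {d = d} [] = d ∣0
∣sum+sum {d = d} {xs = x ∷ xs} {zs = z ∷ zs} (x+z ∷ rest) =
  subst (d ∣_) (ℕ-+.interchange x z (sum xs) (sum zs)) (∣m∣n⇒∣m+n x+z (∣sum+sum rest))

module _ (m : ℕ) .{{_ : NonZero m}} where

  PalindromicMod-even⇒2∣sum : ∀ xs ys → 2 ∣ m → length xs ≡ length ys →
    PalindromicMod m (xs ++ ys) → 2 ∣ sum (xs ++ ys)
  PalindromicMod-even⇒2∣sum xs ys 2∣m |xs|≡|ys| pal =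
    subst (2 ∣_) (trans (cong (sum xs +_) (sum-↭ (↭-reverse ys))) (sym (sum-++ xs ys)))
          (∣sum+sum (Pointwise.map ≡mod-m⇒2∣+ (proj₁ (Palindromic-++-centre⁻ xs {[]} ys |xs|≡|ys| pal))))
    where
      ≡mod-m⇒2∣+ : a ≡[mod m ] b → 2 ∣ a + b
      ≡mod-m⇒2∣+ {a} {b} a≡b = 2∣+-of-≡mod2 {a} {b}
        (trans (sym (m∣n⇒o%n%m≡o%m 2 m a 2∣m)) (trans (cong (_% 2) a≡b) (m∣n⇒o%n%m≡o%m 2 m b 2∣m)))

  palComps : ℕ → List (List ℕ)
  palComps n = filter (palMod? m) (compositions n)

  ∈-palComps⁺ : IsComposition n σ → PalindromicMod m σ → σ ∈ palComps n
  ∈-palComps⁺ {n} comp pal = ∈-filter⁺ (palMod? m) (∈-compsAux⁺ n n ≤-refl comp) pal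

  ∈-palComps⁻ : σ ∈ palComps n → IsComposition n σ × PalindromicMod m σ
  ∈-palComps⁻ {n = n} σ∈ with ∈-filter⁻ (palMod? m) σ∈
  ... | σ∈comps , pal = ∈-compsAux⁻ n n σ∈comps , pal

  palComps-unique : ∀ n → Unique (palComps n)
  palComps-unique n = Unique.filter⁺ (palMod? m) (compsAux-unique n n)

  palComps-swapCentre : ∀ xs {mid mid′} ys → length xs ≡ length ys → All NonZero mid′ → PalindromicMod m mid′ →
    (∀ s → sum mid + s ≡ n → sum mid′ + s ≡ N) →
    xs ++ mid ++ ys ∈ palComps n → xs ++ mid′ ++ ys ∈ palComps N
  palComps-swapCentre xs {mid} {mid′} ys |xs|≡|ys| mid′≠0 mid′-pal sums σ∈ with ∈-palComps⁻ σ∈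
  ... | comp , pal = ∈-palComps⁺ (IsComposition-swapCentre xs {mid} {mid′} ys mid′≠0 sums comp)
                                 (Palindromic-swapCentre xs {mid} {mid′} ys |xs|≡|ys| mid′-pal pal)

data Halves {A : Set} : List A → Set where
  even : ∀ xs ys → length xs ≡ length ys → Halves (xs ++ ys)
  odd  : ∀ xs c ys → length xs ≡ length ys → Halves (xs ++ c ∷ ys)

length-∷ʳ : ∀ (xs : List A) x → length (xs ∷ʳ x) ≡ suc (length xs)
length-∷ʳ xs x = trans (length-++ xs) (+-comm (length xs) 1)

Halves-∷ʳ : Halves σ → ∀ y → Halves (σ ∷ʳ y)
Halves-∷ʳ (even [] [] _) y = odd [] y [] refl
Halves-∷ʳ (even xs (c ∷ ys) |xs|≡|c∷ys|) y =
  subst Halves (sym (++-assoc xs (c ∷ ys) (y ∷ [])))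
        (odd xs c (ys ∷ʳ y) (trans |xs|≡|c∷ys| (sym (length-∷ʳ ys y))))
Halves-∷ʳ (odd xs c ys |xs|≡|ys|) y =
  subst Halves (trans (∷ʳ-++ xs c (ys ∷ʳ y)) (sym (++-assoc xs (c ∷ ys) (y ∷ []))))
        (even (xs ∷ʳ c) (ys ∷ʳ y) (trans (length-∷ʳ xs c) (trans (cong suc |xs|≡|ys|) (sym (length-∷ʳ ys y)))))

halves : (σ : List A) → Halves σ
halves σ = fromReverse (reverseView σ)
  where
    fromReverse : ∀ {σ} → Reverse σ → Halves σ
    fromReverse [] = even [] [] refl
    fromReverse (_ ∶ r ∶ʳ y) = Halves-∷ʳ (fromReverse r) y

-- onCentreAt f g (length σ) σ applies f to the second half of an even-length σ,
-- and g to the suffix of an odd-length σ that starts at its central entry.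
onCentreAt : (List A → List A) → (List A → List A) → ℕ → List A → List A
onCentreAt f g zero          σ       = f σ
onCentreAt f g (suc zero)    σ       = g σ
onCentreAt f g (suc (suc k)) []      = []
onCentreAt f g (suc (suc k)) (x ∷ σ) = x ∷ onCentreAt f g k σ

onCentre : (List A → List A) → (List A → List A) → List A → List A
onCentre f g σ = onCentreAt f g (length σ) σ

onCentreAt-++ : ∀ (f g : List A → List A) xs r (σ : List A) →
  onCentreAt f g (length xs * 2 + r) (xs ++ σ) ≡ xs ++ onCentreAt f g r σ
onCentreAt-++ f g []       r σ = refl
onCentreAt-++ f g (x ∷ xs) r σ = cong (x ∷_) (onCentreAt-++ f g xs r σ)

a+[b+a]≡a*2+b : ∀ a b → a + (b + a) ≡ a * 2 + b
a+[b+a]≡a*2+b = solve-∀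

onCentre-++ : ∀ (f g : List A → List A) xs {mid} ys → length xs ≡ length ys →
  onCentre f g (xs ++ mid ++ ys) ≡ xs ++ onCentreAt f g (length mid) (mid ++ ys)
onCentre-++ f g xs {mid} ys |xs|≡|ys| =
  trans (cong (λ k → onCentreAt f g k (xs ++ mid ++ ys)) length≡) (onCentreAt-++ f g xs (length mid) (mid ++ ys))
  where
    length≡ : length (xs ++ mid ++ ys) ≡ length xs * 2 + length mid
    length≡ = begin
      length (xs ++ mid ++ ys)                ≡⟨ length-++ xs ⟩
      length xs + length (mid ++ ys)          ≡⟨ cong (length xs +_) (length-++ mid) ⟩
      length xs + (length mid + length ys)    ≡⟨ cong (λ l → length xs + (length mid + l)) (sym |xs|≡|ys|) ⟩
      length xs + (length mid + length xs)    ≡⟨ a+[b+a]≡a*2+b (length xs) (length mid) ⟩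
      length xs * 2 + length mid              ∎
      where open ≡-Reasoning

incrementHead : List ℕ → List ℕ
incrementHead []      = []
incrementHead (c ∷ σ) = suc c ∷ σ

decrementHead : List ℕ → List ℕ
decrementHead (suc zero ∷ σ)    = σ
decrementHead (suc (suc c) ∷ σ) = suc c ∷ σ
decrementHead (zero ∷ σ)        = zero ∷ σ
decrementHead []                = []

growCentre : List ℕ → List ℕ
growCentre = onCentre (1 ∷_) incrementHead

-- On even-length lists shrinkCentre is the identity; they never occur below.
shrinkCentre : List ℕ → List ℕ
shrinkCentre = onCentre id decrementHead

growCentre-even : ∀ xs ys → length xs ≡ length ys → growCentre (xs ++ ys) ≡ xs ++ 1 ∷ ys
growCentre-even xs ys = onCentre-++ (1 ∷_) incrementHead xs {[]} ys

growCentre-odd : ∀ xs c ys → length xs ≡ length ys → growCentre (xs ++ c ∷ ys) ≡ xs ++ suc c ∷ ys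
growCentre-odd xs c ys = onCentre-++ (1 ∷_) incrementHead xs {c ∷ []} ys

shrinkCentre-one : ∀ xs ys → length xs ≡ length ys → shrinkCentre (xs ++ 1 ∷ ys) ≡ xs ++ ys
shrinkCentre-one xs ys = onCentre-++ id decrementHead xs {1 ∷ []} ys

shrinkCentre-suc : ∀ xs c ys → length xs ≡ length ys → shrinkCentre (xs ++ suc (suc c) ∷ ys) ≡ xs ++ suc c ∷ ys
shrinkCentre-suc xs c ys = onCentre-++ id decrementHead xs {suc (suc c) ∷ []} ys

module _ (m : ℕ) .{{_ : NonZero m}} where

  growCentre-∈ : τ ∈ palComps m n → growCentre τ ∈ palComps m (suc n) × shrinkCentre (growCentre τ) ≡ τ
  growCentre-∈ {τ = τ} {n = n} τ∈ with halves τ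
  ... | even xs ys e =
    subst (_∈ palComps m (suc n)) (sym (growCentre-even xs ys e))
          (palComps-swapCentre m {n = n} xs {[]} ys e (_ ∷ []) (refl ∷ []) (λ _ → cong suc) τ∈) ,
    trans (cong shrinkCentre (growCentre-even xs ys e)) (shrinkCentre-one xs ys e)
  ... | odd xs zero ys e with () ← All.head (All.++⁻ʳ xs (proj₁ (proj₁ (∈-palComps⁻ m {n = n} τ∈))))
  ... | odd xs (suc c) ys e =
    subst (_∈ palComps m (suc n)) (sym (growCentre-odd xs (suc c) ys e))
          (palComps-swapCentre m {n = n} xs {suc c ∷ []} ys e (_ ∷ []) (refl ∷ []) (λ _ → cong suc) τ∈) ,
    trans (cong shrinkCentre (growCentre-odd xs (suc c) ys e)) (shrinkCentre-suc xs c ys e)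

  shrinkCentre-∈ : 2 ∣ m → 2 ∤ suc n → σ ∈ palComps m (suc n) →
    shrinkCentre σ ∈ palComps m n × growCentre (shrinkCentre σ) ≡ σ
  shrinkCentre-∈ {n = n} {σ} 2∣m 2∤ σ∈ with halves σ | ∈-palComps⁻ m {n = suc n} σ∈
  ... | even xs ys e | (_ , Σ≡) , pal =
    contradiction (subst (2 ∣_) Σ≡ (PalindromicMod-even⇒2∣sum m xs ys 2∣m e pal)) 2∤
  ... | odd xs zero ys e | (≠0 , _) , _ with () ← All.head (All.++⁻ʳ xs ≠0)
  ... | odd xs (suc zero) ys e | _ =
    subst (_∈ palComps m n) (sym (shrinkCentre-one xs ys e))
          (palComps-swapCentre m {n = suc n} xs {1 ∷ []} ys e [] [] (λ _ → suc-injective) σ∈) ,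
    trans (cong growCentre (shrinkCentre-one xs ys e)) (growCentre-even xs ys e)
  ... | odd xs (suc (suc c)) ys e | _ =
    subst (_∈ palComps m n) (sym (shrinkCentre-suc xs c ys e))
          (palComps-swapCentre m {n = suc n} xs {suc (suc c) ∷ []} ys e (_ ∷ []) (refl ∷ []) (λ _ → suc-injective) σ∈) ,
    trans (cong growCentre (shrinkCentre-suc xs c ys e)) (growCentre-odd xs (suc c) ys e)

  pc-suc : 2 ∣ m → 2 ∤ suc n → pc n m ≡ pc (suc n) m
  pc-suc {n} 2∣m 2∤ = length-≡-of-inverses growCentre shrinkCentre
    (palComps-unique m n) (palComps-unique m (suc n)) (growCentre-∈ {n = n}) (shrinkCentre-∈ 2∣m 2∤)

2∤1+2*n : ∀ n → 2 ∤ suc (2 * n)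
2∤1+2*n n 2∣1+2n with ∣1⇒≡1 (∣m+n∣m⇒∣n (subst (2 ∣_) (+-comm 1 (2 * n)) 2∣1+2n) (divides n (*-comm 2 n)))
... | ()

proposition1 : (m : ℕ) → .{{_ : NonZero m}} → 2 ∣ m → (n : ℕ) → 1 ≤ n →
               pc (2 * n) m ≡ pc (suc (2 * n)) m
proposition1 m 2∣m n _ = pc-suc m 2∣m (2∤1+2*n n)
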